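{- Let $\mathcal{A}$ and $\mathcal{B}$ be presentations of a transversal matroid $M$. If $M_1$ and $M_2$ are in both $T_\mathcal{A}$ and $T_\mathcal{B}$, then their join in $T_\mathcal{A}$ equals their join in $T_\mathcal{B}$.
   Context: Let $r=r(M)$ and $[r]=\{1,\dots,r\}$. For a set system $\mathcal{A}=(A_i:i\in[r])$ on a finite set $E$, $M[\mathcal{A}]$ is the transversal matroid on $E$ whose independent sets are the partial transversals of $\mathcal{A}$ (sets $X$ with an injection $\phi:X\to[r]$, $e\in A_{\phi(e)}$); $\mathcal{A}$ is a presentation of $M[\mathcal{A}]$, with exactly $r$ sets. Fix $x\notin E$; for $I\subseteq[r]$, $\mathcal{A}^I$ is obtained from $\mathcal{A}$ by replacing $A_i$ by $A_i\cup\{x\}$ for each $i\in I$. $T_\mathcal{A}=\{M[\mathcal{A}^I]: I\subseteq[r]\}$, ordered by the weak order ($N_1\le_w N_2$ iff every independent set of $N_1$ is independent in $N_2$); it is a lattice. Similarly for $T_\mathcal{B}$. -}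

module Defs where

open import Data.Nat using (ℕ; suc)
open import Data.Fin using (Fin)
open import Data.Fin.Subset using (Subset; _∈_; ∣_∣)
open import Data.Vec using (lookup; _∷_)
open import Data.Product using (Σ; ∃; _×_)
open import Relation.Binary.PropositionalEquality using (_≡_)

SetSystem : ℕ → ℕ → Set
SetSystem r n = Fin r → Subset n

-- A matroid on Fin m, given by its family of independent sets.
MatroidOn : ℕ → Set₁
MatroidOn m = Subset m → Set

PartialTransversal : ∀ {r n} → SetSystem r n → Subset n → Set
PartialTransversal {r} {n} A X =
  Σ (Fin n → Fin r) λ φ →
    (∀ e e′ → e ∈ X → e′ ∈ X → φ e ≡ φ e′ → e ≡ e′) ×
    (∀ e → e ∈ X → e ∈ A (φ e))

M[_] : ∀ {r n} → SetSystem r n → MatroidOn n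
M[ A ] X = PartialTransversal A X

_≅_ : ∀ {m} → MatroidOn m → MatroidOn m → Set
N₁ ≅ N₂ = ∀ X → (N₁ X → N₂ X) × (N₂ X → N₁ X)

_≤w_ : ∀ {m} → MatroidOn m → MatroidOn m → Set
N₁ ≤w N₂ = ∀ X → N₁ X → N₂ X

-- The new element x is index zero of Fin (suc n); e ∈ E = Fin n is suc e.
-- A^I : replace A_i by A_i ∪ {x} for each i ∈ I.
_^_ : ∀ {r n} → SetSystem r n → Subset r → SetSystem r (suc n)
(A ^ I) i = lookup I i ∷ A i

_∈T_ : ∀ {r n} → MatroidOn (suc n) → SetSystem r n → Set
N ∈T A = ∃ λ I → N ≅ M[ A ^ I ]

IsJoinIn : ∀ {r n} → SetSystem r n → (N₁ N₂ N : MatroidOn (suc n)) → Set₁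
IsJoinIn A N₁ N₂ N =
  N ∈T A × N₁ ≤w N × N₂ ≤w N ×
  (∀ N′ → N′ ∈T A → N₁ ≤w N′ → N₂ ≤w N′ → N ≤w N′)

-- A is a presentation of M (with exactly r = r(M) sets).
IsPresentation : ∀ {r n} → SetSystem r n → MatroidOn n → Set
IsPresentation {r} A M =
  (M ≅ M[ A ]) × (∃ λ X → M X × ∣ X ∣ ≡ r) × (∀ X → M X → ∣ X ∣ Data.Nat.≤ r)
  where import Data.Nat

module Submission where

-- Since the new
-- element x = zero can be matched to at most one index of [r], a set X is
-- independent in M[A^(I ∪ K)] exactly when it is independent in M[A^I] or
-- in M[A^K]: reroute the matching of x into whichever of I, K contains its
-- index.  Together with monotonicity of I ↦ M[A^I] this shows that the join
-- of M[A^I] and M[A^K] in T_A is M[A^(I ∪ K)], whose independent sets are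
-- the union of those of the two matroids.  This description of the join does
-- not mention the presentation A at all, so two presentations A and B
-- yield the same join of any two common members of T_A and T_B.

open import Defs
open import Data.Nat using (suc)
open import Data.Fin using (Fin; zero; suc)
open import Data.Fin.Subset using (Subset; _∈_; _∪_; _⊆_; inside)
open import Data.Fin.Subset.Properties using (p⊆p∪q; q⊆p∪q; x∈p∪q⁻; _∈?_)
open import Data.Vec using (lookup; _∷_; here; there)
open import Data.Vec.Properties using ([]=⇒lookup; lookup⇒[]=)
open import Data.Product using (_,_; proj₁; proj₂)
open import Data.Sum using (_⊎_; inj₁; inj₂; [_,_])
open import Data.Empty using (⊥-elim)
open import Relation.Nullary using (yes; no)
open import Relation.Binary.PropositionalEquality using (_≡_; refl)

∷-change-head : ∀ {n b b′} {S : Subset n} (e : Fin (suc n)) →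
                e ∈ (b ∷ S) → (e ≡ zero → b′ ≡ inside) → e ∈ (b′ ∷ S)
∷-change-head zero    here      b′-inside rewrite b′-inside refl = here
∷-change-head (suc e) (there p) _                               = there p

x-index∈ : ∀ {r n} (A : SetSystem r n) (I : Subset r) {X : Subset (suc n)} →
           (t : M[ A ^ I ] X) → zero ∈ X → proj₁ t zero ∈ I
x-index∈ A I {X} (φ , _ , match) x∈X = lookup⇒[]= (φ zero) I (head-inside (match zero x∈X))
  where
    head-inside : ∀ {b} {S : Subset _} → zero ∈ (b ∷ S) → b ≡ inside
    head-inside here = refl

reroute : ∀ {r n} (A : SetSystem r n) (I K : Subset r) {X : Subset (suc n)} →
          (t : M[ A ^ I ] X) → (zero ∈ X → proj₁ t zero ∈ K) → M[ A ^ K ] X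
reroute A I K (φ , injective , match) x-index∈K =
  φ , injective ,
  λ e e∈X → ∷-change-head e (match e e∈X) (λ { refl → []=⇒lookup (x-index∈K e∈X) })

^-mono : ∀ {r n} (A : SetSystem r n) (I K : Subset r) → I ⊆ K →
         M[ A ^ I ] ≤w M[ A ^ K ]
^-mono A I K I⊆K X t = reroute A I K t (λ x∈X → I⊆K (x-index∈ A I t x∈X))

^-∪-split : ∀ {r n} (A : SetSystem r n) (I K : Subset r) (X : Subset (suc n)) →
            M[ A ^ (I ∪ K) ] X → M[ A ^ I ] X ⊎ M[ A ^ K ] X
^-∪-split A I K X t with proj₁ t zero ∈? I
... | yes x-index∈I = inj₁ (reroute A (I ∪ K) I t (λ _ → x-index∈I))
... | no  x-index∉I = inj₂ (reroute A (I ∪ K) K t x-index∈K)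
  where
    x-index∈K : zero ∈ X → proj₁ t zero ∈ K
    x-index∈K x∈X =
      [ (λ ∈I → ⊥-elim (x-index∉I ∈I)) , (λ ∈K → ∈K) ]
        (x∈p∪q⁻ I K (x-index∈ A (I ∪ K) t x∈X))

_∪M_ : ∀ {m} → MatroidOn m → MatroidOn m → MatroidOn m
(N₁ ∪M N₂) X = N₁ X ⊎ N₂ X

≅-sym : ∀ {m} {N₁ N₂ : MatroidOn m} → N₁ ≅ N₂ → N₂ ≅ N₁
≅-sym N₁≅N₂ X = proj₂ (N₁≅N₂ X) , proj₁ (N₁≅N₂ X)

≅-trans : ∀ {m} {N₁ N₂ N₃ : MatroidOn m} → N₁ ≅ N₂ → N₂ ≅ N₃ → N₁ ≅ N₃
≅-trans N₁≅N₂ N₂≅N₃ X =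
  (λ i → proj₁ (N₂≅N₃ X) (proj₁ (N₁≅N₂ X) i)) ,
  (λ i → proj₂ (N₁≅N₂ X) (proj₂ (N₂≅N₃ X) i))

-- A join in T_A of two members of T_A has as independent sets exactly the
-- union of theirs: it lies below M[A^(I ∪ K)] and above both matroids.
join-is-union : ∀ {r n} (A : SetSystem r n) (M₁ M₂ J : MatroidOn (suc n)) →
                M₁ ∈T A → M₂ ∈T A → IsJoinIn A M₁ M₂ J → J ≅ (M₁ ∪M M₂)
join-is-union A M₁ M₂ J (I , M₁≅) (K , M₂≅) (_ , M₁≤J , M₂≤J , least) X =
  to-union , from-union
  where
    U : MatroidOn (suc _)
    U = M[ A ^ (I ∪ K) ]

    M₁≤U : M₁ ≤w U
    M₁≤U Y i = ^-mono A I (I ∪ K) (p⊆p∪q K) Y (proj₁ (M₁≅ Y) i)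

    M₂≤U : M₂ ≤w U
    M₂≤U Y i = ^-mono A K (I ∪ K) (q⊆p∪q I K) Y (proj₁ (M₂≅ Y) i)

    J≤U : J ≤w U
    J≤U = least U ((I ∪ K) , λ Y → (λ i → i) , (λ i → i)) M₁≤U M₂≤U

    to-union : J X → (M₁ ∪M M₂) X
    to-union j with ^-∪-split A I K X (J≤U X j)
    ... | inj₁ i = inj₁ (proj₂ (M₁≅ X) i)
    ... | inj₂ i = inj₂ (proj₂ (M₂≅ X) i)

    from-union : (M₁ ∪M M₂) X → J X
    from-union (inj₁ i) = M₁≤J X i
    from-union (inj₂ i) = M₂≤J X i

-- Both joins equal the union of the independent sets of M₁ and M₂.
corollary3p13 : ∀ {r n} (M : MatroidOn n) (A B : SetSystem r n) →
    IsPresentation A M → IsPresentation B M →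
    (M₁ M₂ : MatroidOn (suc n)) →
    M₁ ∈T A → M₁ ∈T B → M₂ ∈T A → M₂ ∈T B →
    (J₁ J₂ : MatroidOn (suc n)) →
    IsJoinIn A M₁ M₂ J₁ → IsJoinIn B M₁ M₂ J₂ →
    J₁ ≅ J₂
corollary3p13 M A B _ _ M₁ M₂ M₁∈A M₁∈B M₂∈A M₂∈B J₁ J₂ J₁-join J₂-join =
  ≅-trans (join-is-union A M₁ M₂ J₁ M₁∈A M₂∈A J₁-join)
          (≅-sym (join-is-union B M₁ M₂ J₂ M₁∈B M₂∈B J₂-join))
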